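{- Let $n\ge1$, $\pi\in S_{n+1}$, and let $k:\Phi^+\to\mathbb{Z}$ be the address of an alcove $\mathcal{A}$ (in step coordinates) contained in the polytope of steps $P_\pi$. Then for any $(i',j')\in I_\pi$ and any $(i,j)\in C_\pi$ such that $k(i,j)=0$, we have $k(i',j')=0$.
   Context: $\Phi^+=\{(i,j):1\le i<j\le n+1\}$. In step coordinates, alcoves are the nonempty sets of the form $\{x\in\mathbb{R}^n: k(i,j)<x_i+\cdots+x_{j-1}<k(i,j)+1 \text{ for all }(i,j)\in\Phi^+\}$ for $k:\Phi^+\to\mathbb{Z}$ (the address); equivalently the connected components of the complement of all hyperplanes $x_i+\cdots+x_{j-1}=a$, $a\in\mathbb{Z}$. With $m_c=\min\{\pi(c),\pi(c+1)\}$, $M_c=\max\{\pi(c),\pi(c+1)\}$, $P_\pi$ is the set of $x\in\mathbb{R}^n$ with $x_i\ge0$ and $0\le x_{m_c}+\cdots+x_{M_c-1}\le1$ for all $c\in[n]$. The set of consecutive roots is $C_\pi=\{(m_c,M_c):c\in[n]\}$. The root poset order is $(i',j')\le(i,j)$ iff $i\le i'<j'\le j$, and $I_\pi=\{(i',j')\in\Phi^+:(i',j')\le(i,j)\text{ for some }(i,j)\in C_\pi\}$.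
   Formalization: Points of the alcove $\mathcal{A}$ and of the polytope of steps $P_\pi$ are taken in ℚ^n rather than ℝ^n. -}

module Defs where

open import Data.Nat as ℕ using (ℕ; zero; suc)
open import Data.Integer as ℤ using (ℤ)
open import Data.Rational as ℚ using (ℚ; 0ℚ; 1ℚ)
open import Data.Fin using (Fin; toℕ; inject₁) renaming (suc to fsuc; zero to fzero)
open import Data.Fin.Permutation using (Permutation′; _⟨$⟩ʳ_)
open import Data.Product using (Σ; ∃; _×_; _,_)
open import Data.Bool using (if_then_else_)
open import Relation.Nullary.Decidable using (⌊_⌋; _×-dec_)
open import Relation.Binary.PropositionalEquality using (_≡_)

-- Points of ℚ^n in step coordinates: x l is the coordinate x_{toℕ l + 1}.
Point : ℕ → Set
Point n = Fin n → ℚ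

sumFin : ∀ {n} → (Fin n → ℚ) → ℚ
sumFin {zero}  f = 0ℚ
sumFin {suc n} f = f fzero ℚ.+ sumFin (λ l → f (fsuc l))

-- stepSum x i j = x_i + ... + x_{j-1}  (1-based indices)
stepSum : ∀ {n} → Point n → ℕ → ℕ → ℚ
stepSum x i j = sumFin (λ l → if ⌊ (i ℕ.≤? suc (toℕ l)) ×-dec (suc (toℕ l) ℕ.<? j) ⌋
                                then x l else 0ℚ)

record Root (n : ℕ) : Set where
  constructor root
  field
    i j : ℕ
    1≤i : 1 ℕ.≤ i
    i<j : i ℕ.< j
    j≤ : j ℕ.≤ suc n
open Root public

InAlcove : ∀ {n} → (Root n → ℤ) → Point n → Set
InAlcove k x = ∀ r → ((k r ℚ./ 1) ℚ.< stepSum x (i r) (j r))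
                   × (stepSum x (i r) (j r) ℚ.< ((k r ℤ.+ ℤ.+ 1) ℚ./ 1))

IsAlcoveAddress : ∀ {n} → (Root n → ℤ) → Set
IsAlcoveAddress {n} k = Σ (Point n) (InAlcove k)

-- π(c) for c ∈ [n+1], as a number in 1..n+1 (π : Fin (n+1) ↔ Fin (n+1), 0-based)
πval : ∀ {n} → Permutation′ (suc n) → Fin (suc n) → ℕ
πval π c = suc (toℕ (π ⟨$⟩ʳ c))

-- m_c and M_c for c ∈ [n]  (c : Fin n encodes c = toℕ c + 1; positions c, c+1)
mc Mc : ∀ {n} → Permutation′ (suc n) → Fin n → ℕ
mc π c = ℕ._⊓_ (πval π (inject₁ c)) (πval π (fsuc c))
Mc π c = ℕ._⊔_ (πval π (inject₁ c)) (πval π (fsuc c))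

InP : ∀ {n} → Permutation′ (suc n) → Point n → Set
InP {n} π x = (∀ l → 0ℚ ℚ.≤ x l)
            × (∀ (c : Fin n) → (0ℚ ℚ.≤ stepSum x (mc π c) (Mc π c))
                              × (stepSum x (mc π c) (Mc π c) ℚ.≤ 1ℚ))

AlcoveInP : ∀ {n} → Permutation′ (suc n) → (Root n → ℤ) → Set
AlcoveInP π k = ∀ x → InAlcove k x → InP π x

InC : ∀ {n} → Permutation′ (suc n) → Root n → Set
InC {n} π r = ∃ λ (c : Fin n) → (i r ≡ mc π c) × (j r ≡ Mc π c)

_≤R_ : ∀ {n} → Root n → Root n → Set
r′ ≤R r = (i r ℕ.≤ i r′) × (j r′ ℕ.≤ j r)

InI : ∀ {n} → Permutation′ (suc n) → Root n → Set
InI π r′ = ∃ λ r → InC π r × (r′ ≤R r)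

-- On P_π all steps are nonnegative, so the step sum over a root can only shrink as the
-- root moves down the root poset. Every root of I_π lies below a consecutive root, whose
-- step sum is at most 1 on P_π; hence on any alcove inside P_π the step sum of such a root
-- stays in [0,1], which forces its address to be 0.
module Submission where

open import Defs
open import Data.Nat using (ℕ; suc; _≥_)
open import Data.Integer using (ℤ; +_)
open import Data.Fin.Permutation using (Permutation′)
open import Relation.Binary.PropositionalEquality using (_≡_)

import Data.Nat as ℕ
import Data.Nat.Properties as ℕ
import Data.Integer as ℤ
import Data.Integer.Properties as ℤ
import Data.Rational as ℚ
import Data.Rational.Properties as ℚ
open import Data.Rational using (ℚ; mkℚ; 0ℚ; 1ℚ; *<*)
import Data.Nat.Coprimality as Coprimality
open import Data.Fin using (Fin; toℕ) renaming (suc to fsuc; zero to fzero)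
open import Data.Bool using (if_then_else_)
open import Data.Product using (_,_; proj₁; proj₂)
open import Data.Empty using (⊥-elim)
open import Relation.Nullary using (yes; no)
open import Relation.Nullary.Decidable using (⌊_⌋; _×-dec_)
open import Relation.Binary.PropositionalEquality using (refl; cong; subst₂)

sumFin-mono-≤ : ∀ {n} {f g : Fin n → ℚ} → (∀ l → f l ℚ.≤ g l) → sumFin f ℚ.≤ sumFin g
sumFin-mono-≤ {ℕ.zero} f≤g = ℚ.≤-refl
sumFin-mono-≤ {suc n}  f≤g = ℚ.+-mono-≤ (f≤g fzero) (sumFin-mono-≤ (λ l → f≤g (fsuc l)))

sumFin-nonNegative : ∀ {n} {f : Fin n → ℚ} → (∀ l → 0ℚ ℚ.≤ f l) → 0ℚ ℚ.≤ sumFin f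
sumFin-nonNegative {ℕ.zero} 0≤f = ℚ.≤-refl
sumFin-nonNegative {suc n}  0≤f = ℚ.+-mono-≤ (0≤f fzero) (sumFin-nonNegative (λ l → 0≤f (fsuc l)))

NonNegative : ∀ {n} → Point n → Set
NonNegative x = ∀ l → 0ℚ ℚ.≤ x l

stepTerm : ∀ {n} → Point n → ℕ → ℕ → Fin n → ℚ
stepTerm x i j l = if ⌊ (i ℕ.≤? suc (toℕ l)) ×-dec (suc (toℕ l) ℕ.<? j) ⌋ then x l else 0ℚ

stepTerm-nonNegative : ∀ {n} {x : Point n} → NonNegative x → ∀ i j l → 0ℚ ℚ.≤ stepTerm x i j l
stepTerm-nonNegative 0≤x i j l with (i ℕ.≤? suc (toℕ l)) ×-dec (suc (toℕ l) ℕ.<? j)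
... | yes _ = 0≤x l
... | no _  = ℚ.≤-refl

stepTerm-antitone : ∀ {n} {x : Point n} → NonNegative x → ∀ {i j i′ j′} → i ℕ.≤ i′ → j′ ℕ.≤ j →
                    ∀ l → stepTerm x i′ j′ l ℚ.≤ stepTerm x i j l
stepTerm-antitone 0≤x {i} {j} {i′} {j′} i≤i′ j′≤j l
  with (i′ ℕ.≤? suc (toℕ l)) ×-dec (suc (toℕ l) ℕ.<? j′) | (i ℕ.≤? suc (toℕ l)) ×-dec (suc (toℕ l) ℕ.<? j)
... | yes _             | yes _   = ℚ.≤-refl
... | no _              | yes _   = 0≤x l
... | no _              | no _    = ℚ.≤-refl
... | yes (i′≤l , l<j′) | no l∉ij = ⊥-elim (l∉ij (ℕ.≤-trans i≤i′ i′≤l , ℕ.<-≤-trans l<j′ j′≤j))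

stepSum-nonNegative : ∀ {n} (x : Point n) → NonNegative x → ∀ i j → 0ℚ ℚ.≤ stepSum x i j
stepSum-nonNegative x 0≤x i j = sumFin-nonNegative (stepTerm-nonNegative 0≤x i j)

stepSum-antitone : ∀ {n} (x : Point n) → NonNegative x → ∀ {r′ r : Root n} → r′ ≤R r →
                   stepSum x (i r′) (j r′) ℚ.≤ stepSum x (i r) (j r)
stepSum-antitone x 0≤x (i≤i′ , j′≤j) = sumFin-mono-≤ (stepTerm-antitone 0≤x i≤i′ j′≤j)

InP⇒stepSum≤1 : ∀ {n} (π : Permutation′ (suc n)) (x : Point n) → InP π x →
                ∀ r′ → InI π r′ → stepSum x (i r′) (j r′) ℚ.≤ 1ℚ
InP⇒stepSum≤1 π x (0≤x , consecutive≤1) r′ (r , (c , i≡m , j≡M) , r′≤r) =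
  ℚ.≤-trans (stepSum-antitone x 0≤x {r′} {r} r′≤r) r≤1
  where
  r≤1 : stepSum x (i r) (j r) ℚ.≤ 1ℚ
  r≤1 rewrite i≡m | j≡M = proj₂ (consecutive≤1 c)

/1≡mkℚ : ∀ z → z ℚ./ 1 ≡ mkℚ z 0 (Coprimality.sym (Coprimality.1-coprimeTo ℤ.∣ z ∣))
/1≡mkℚ (+ m)      = ℚ.normalize-coprime {m} _
/1≡mkℚ ℤ.-[1+ m ] = cong ℚ.-_ (ℚ.normalize-coprime {suc m} _)

/1-cancel-< : ∀ {y z} → y ℚ./ 1 ℚ.< z ℚ./ 1 → y ℤ.< z
/1-cancel-< {y} {z} y<z with subst₂ ℚ._<_ (/1≡mkℚ y) (/1≡mkℚ z) y<z
... | *<* y*1<z*1 = subst₂ ℤ._<_ (ℤ.*-identityʳ y) (ℤ.*-identityʳ z) y*1<z*1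

z<1∧0<z+1⇒z≡0 : ∀ z → z ℤ.< + 1 → + 0 ℤ.< z ℤ.+ + 1 → z ≡ + 0
z<1∧0<z+1⇒z≡0 (+ 0)          _                  _          = refl
z<1∧0<z+1⇒z≡0 (+ suc m)      (ℤ.+<+ (ℕ.s≤s ())) _
z<1∧0<z+1⇒z≡0 ℤ.-[1+ 0 ]     _                  (ℤ.+<+ ())
z<1∧0<z+1⇒z≡0 ℤ.-[1+ suc m ] _                  ()

address≡0-on-unitInterval : ∀ {z : ℤ} {s : ℚ} → z ℚ./ 1 ℚ.< s → s ℚ.< (z ℤ.+ + 1) ℚ./ 1 →
                            0ℚ ℚ.≤ s → s ℚ.≤ 1ℚ → z ≡ + 0
address≡0-on-unitInterval {z} z<s s<z+1 0≤s s≤1 =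
  z<1∧0<z+1⇒z≡0 z (/1-cancel-< (ℚ.<-≤-trans z<s s≤1)) (/1-cancel-< (ℚ.≤-<-trans 0≤s s<z+1))

InI⇒address≡0 : ∀ {n} (π : Permutation′ (suc n)) (k : Root n → ℤ) → IsAlcoveAddress k → AlcoveInP π k →
                ∀ r′ → InI π r′ → k r′ ≡ + 0
InI⇒address≡0 π k (x , x∈A) A⊆P r′ r′∈I =
  address≡0-on-unitInterval {k r′} (proj₁ (x∈A r′)) (proj₂ (x∈A r′))
    (stepSum-nonNegative x (proj₁ x∈P) (i r′) (j r′)) (InP⇒stepSum≤1 π x x∈P r′ r′∈I)
  where
  x∈P : InP π x
  x∈P = A⊆P x x∈A

lemma5p23 : (n : ℕ) → n ≥ 1 → (π : Permutation′ (suc n)) → (k : Root n → ℤ)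
    → IsAlcoveAddress k → AlcoveInP π k
    → ∀ (r′ r : Root n) → InI π r′ → InC π r → k r ≡ + 0 → k r′ ≡ + 0
lemma5p23 n _ π k isAddress A⊆P r′ _ r′∈I _ _ = InI⇒address≡0 π k isAddress A⊆P r′ r′∈I
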